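{- Let $G$ be a cubic bipartite graph and let $e,f\in E(G)$. If every $3$-edge-cut of $G$ contains at most one edge of $\{e,f\}$, then $G$ has a $1$-factor (perfect matching) containing both $e$ and $f$.
   Context: Graphs are finite and may have parallel edges. An edge-cut is the set of all edges with one end in $W$ and the other in $V(G)\setminus W$, for some $\emptyset\ne W\subsetneq V(G)$; a $3$-edge-cut is an edge-cut with exactly $3$ edges (trivial ones, consisting of the three edges at a vertex, included). -}

module Defs where

open import Data.Nat using (ℕ; zero; suc; _+_)
open import Data.Fin using (Fin; _≟_)
import Data.Fin as Fin
open import Data.Bool using (Bool; true; false; not; _∧_; _∨_; _xor_; if_then_else_)
open import Data.Product using (_×_; _,_; proj₁; proj₂; Σ; ∃)
open import Relation.Binary.PropositionalEquality using (_≡_; _≢_)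
open import Relation.Nullary.Decidable using (⌊_⌋)

count : ∀ {k} → (Fin k → Bool) → ℕ
count {zero}  P = 0
count {suc k} P = (if P Fin.zero then 1 else 0) + count (λ i → P (Fin.suc i))

-- A finite multigraph: vertices Fin n, edges Fin m, each edge has an
-- (unordered) pair of endpoints, recorded as an ordered pair.
record Graph : Set where
  field
    n   : ℕ
    m   : ℕ
    ends : Fin m → Fin n × Fin n

open Graph public

V : Graph → Set
V G = Fin (n G)

E : Graph → Set
E G = Fin (m G)

incidence : (G : Graph) → V G → E G → ℕ
incidence G v e =
  (if ⌊ proj₁ (ends G e) ≟ v ⌋ then 1 else 0) + (if ⌊ proj₂ (ends G e) ≟ v ⌋ then 1 else 0)

incident : (G : Graph) → V G → E G → Bool
incident G v e = ⌊ proj₁ (ends G e) ≟ v ⌋ ∨ ⌊ proj₂ (ends G e) ≟ v ⌋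

degree : (G : Graph) → V G → ℕ
degree G v = sumE (incidence G v)
  where
  sumF : ∀ {k} → (Fin k → ℕ) → ℕ
  sumF {zero}  f = 0
  sumF {suc k} f = f Fin.zero + sumF (λ i → f (Fin.suc i))
  sumE : (E G → ℕ) → ℕ
  sumE = sumF

Cubic : Graph → Set
Cubic G = ∀ (v : V G) → degree G v ≡ 3

Bipartite : Graph → Set
Bipartite G = Σ (V G → Bool) λ c → ∀ (e : E G) → c (proj₁ (ends G e)) ≢ c (proj₂ (ends G e))

inCut : (G : Graph) → (V G → Bool) → E G → Bool
inCut G W e = W (proj₁ (ends G e)) xor W (proj₂ (ends G e))

ProperNonempty : (G : Graph) → (V G → Bool) → Set
ProperNonempty G W = Σ (V G) (λ v → W v ≡ true) × Σ (V G) (λ v → W v ≡ false)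

Is3EdgeCut : (G : Graph) → (V G → Bool) → Set
Is3EdgeCut G W = ProperNonempty G W × count (inCut G W) ≡ 3

-- Number of edges of {e, f} lying in δ(W) (the set {e,f}, so e = f counts once).
countPair : (G : Graph) → (V G → Bool) → E G → E G → ℕ
countPair G W e f = count (λ g → (⌊ g ≟ e ⌋ ∨ ⌊ g ≟ f ⌋) ∧ inCut G W g)

PerfectMatching : (G : Graph) → (E G → Bool) → Set
PerfectMatching G M = ∀ (v : V G) → count (λ e → M e ∧ incident G v e) ≡ 1

-- Colour true is called white, colour false black, and every edge is oriented from its white
-- end (tail) to its black end (head). Put e and f into the matching and let A and B be the
-- white and black vertices other than their ends; |A| = |B|, since double counting the edges
-- of a cubic bipartite graph gives equally many white and black vertices. It remains to match
-- A to B, and by Hall's theorem to show |N(S) ∩ B| ≥ |S| for S ⊆ A. Otherwise take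
-- W = S ∪ (N(S) ∩ B) ∪ {head e, head f}: all edges at S stay inside W, so counting edge ends
-- at the black vertices of W gives |δ(W)| = 3(|N(S) ∩ B| + |{head e, head f}| − |S|), a
-- multiple of 3 that is at most 0 if e = f and at most 3 otherwise. Since e and f lie in δ(W),
-- the first case is impossible and in the second δ(W) is a 3-edge-cut containing both.

module Submission where

open import Defs
open import Data.Bool using (Bool; true; false; not; _∧_; _∨_; _xor_; if_then_else_)
import Data.Bool as Bool
open import Data.Bool.Properties using (∧-zeroʳ; ∧-identityʳ; xor-comm)
open import Data.Empty using (⊥-elim)
open import Data.Fin using (Fin; zero; suc; _≟_)
open import Data.Fin.Properties using (any?; all?)
import Data.Fin.Properties as Finₚ
open import Data.Fin.Subset.Properties using (anySubset?)
open import Data.Nat using (ℕ; zero; suc; _+_; _*_; _≤_; _<_; z≤n; s≤s)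
import Data.Nat as ℕ
open import Data.Nat.Properties hiding (_≟_)
open import Data.Nat.Tactic.RingSolver using (solve-∀)
open import Algebra.Properties.CommutativeMonoid.Sum +-0-commutativeMonoid
  using (sum; sum-cong-≗; ∑-distrib-+; ∑-comm)
open import Data.Product using (Σ; ∃; _×_; _,_; proj₁; proj₂)
open import Data.Sum using (_⊎_; inj₁; inj₂)
import Data.Sum as Sum
open import Data.Vec using (lookup; tabulate)
open import Data.Vec.Properties using (lookup∘tabulate)
open import Function using (_∘_)
open import Relation.Binary.PropositionalEquality
open import Relation.Nullary using (Dec; yes; no; ¬_; contradiction)
open import Relation.Nullary.Decidable using (⌊_⌋; _×-dec_; _→-dec_)

private variable k : ℕ

∧-elimˡ : ∀ {x y} → x ∧ y ≡ true → x ≡ true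
∧-elimˡ {true} _ = refl

∧-elimʳ : ∀ {x y} → x ∧ y ≡ true → y ≡ true
∧-elimʳ {true} p = p

∧-intro : ∀ {x y} → x ≡ true → y ≡ true → x ∧ y ≡ true
∧-intro refl refl = refl

∨-elim : ∀ {x y} → x ∨ y ≡ true → x ≡ true ⊎ y ≡ true
∨-elim {true} _ = inj₁ refl
∨-elim {false} p = inj₂ p

∨-introˡ : ∀ {x y} → x ≡ true → x ∨ y ≡ true
∨-introˡ refl = refl

∨-introʳ : ∀ {x y} → y ≡ true → x ∨ y ≡ true
∨-introʳ {true} _ = refl
∨-introʳ {false} p = p

not-intro : ∀ {x} → x ≡ false → not x ≡ true
not-intro refl = refl

not-elim : ∀ {x} → not x ≡ true → x ≡ false
not-elim {false} _ = refl

true≢false : ∀ {x} → x ≡ true → x ≢ false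
true≢false refl ()

Bool-ext : ∀ {x y} → (x ≡ true → y ≡ true) → (y ≡ true → x ≡ true) → x ≡ y
Bool-ext {false} {false} _ _ = refl
Bool-ext {false} {true} _ y⇒x = y⇒x refl
Bool-ext {true} x⇒y _ = sym (x⇒y refl)

module _ {A : Set} where

  ⌊⌋≡true⇒ : (a? : Dec A) → ⌊ a? ⌋ ≡ true → A
  ⌊⌋≡true⇒ (yes a) _ = a

  ⌊⌋≡false⇒ : (a? : Dec A) → ⌊ a? ⌋ ≡ false → ¬ A
  ⌊⌋≡false⇒ (no ¬a) _ = ¬a

  ⇒⌊⌋≡true : (a? : Dec A) → A → ⌊ a? ⌋ ≡ true
  ⇒⌊⌋≡true (yes _) _ = refl
  ⇒⌊⌋≡true (no ¬a) a = contradiction a ¬a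

  ⇒⌊⌋≡false : (a? : Dec A) → ¬ A → ⌊ a? ⌋ ≡ false
  ⇒⌊⌋≡false (yes a) ¬a = contradiction a ¬a
  ⇒⌊⌋≡false (no _) _ = refl

module _ {A : Set} where

  infixr 7 _∩_ _∖_
  infixr 6 _∪_
  infix 4 _⊆_

  _∩_ _∪_ _∖_ : (A → Bool) → (A → Bool) → A → Bool
  (P ∩ Q) x = P x ∧ Q x
  (P ∪ Q) x = P x ∨ Q x
  (P ∖ Q) x = P x ∧ not (Q x)

  _⊆_ : (A → Bool) → (A → Bool) → Set
  P ⊆ Q = ∀ x → P x ≡ true → Q x ≡ true

-- Oriented like countPair, which is then count ((｛ e ｝ ∪ ｛ f ｝) ∩ inCut G W) by definition.
｛_｝ : Fin k → Fin k → Bool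
｛ x ｝ y = ⌊ y ≟ x ⌋

∈｛｝ : (x : Fin k) → ｛ x ｝ x ≡ true
∈｛｝ x = ⇒⌊⌋≡true (x ≟ x) refl

∈｛｝⇒≡ : ∀ {x y : Fin k} → ｛ x ｝ y ≡ true → y ≡ x
∈｛｝⇒≡ {x = x} {y} = ⌊⌋≡true⇒ (y ≟ x)

∉｛｝ : ∀ {x y : Fin k} → y ≢ x → ｛ x ｝ y ≡ false
∉｛｝ {x = x} {y} = ⇒⌊⌋≡false (y ≟ x)


∈｛,｝⇒ : ∀ {x y i : Fin k} → (｛ x ｝ ∪ ｛ y ｝) i ≡ true → i ≡ x ⊎ i ≡ y
∈｛,｝⇒ p = Sum.map ∈｛｝⇒≡ ∈｛｝⇒≡ (∨-elim p)

∉-removed : (Z : Fin k → Bool) {z x : Fin k} → (Z ∖ ｛ z ｝) x ≡ true → x ≢ z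
∉-removed Z {z} {x} p = ⌊⌋≡false⇒ (x ≟ z) (not-elim (∧-elimʳ {Z x} p))

∉-removed₂ : (Z : Fin k → Bool) {x y v : Fin k} → (Z ∖ (｛ x ｝ ∪ ｛ y ｝)) v ≡ true →
  v ≢ x × v ≢ y
∉-removed₂ Z {x} {y} {v} p =
    (λ v≡x → true≢false (∨-introˡ (⇒⌊⌋≡true (v ≟ x) v≡x)) outside)
  , (λ v≡y → true≢false (∨-introʳ {｛ x ｝ v} (⇒⌊⌋≡true (v ≟ y) v≡y)) outside)
  where
  outside : (｛ x ｝ ∪ ｛ y ｝) v ≡ false
  outside = not-elim (∧-elimʳ {Z v} p)

𝟙 : Bool → ℕ
𝟙 b = if b then 1 else 0

count-as-sum : (P : Fin k → Bool) → count P ≡ sum (𝟙 ∘ P)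
count-as-sum {zero} P = refl
count-as-sum {suc k} P = cong (𝟙 (P zero) +_) (count-as-sum (P ∘ suc))

count-cong : {P Q : Fin k → Bool} → P ≗ Q → count P ≡ count Q
count-cong {zero} _ = refl
count-cong {suc k} P≗Q = cong₂ (λ b n → 𝟙 b + n) (P≗Q zero) (count-cong (P≗Q ∘ suc))

count-none : {P : Fin k → Bool} → (∀ i → P i ≡ false) → count P ≡ 0
count-none {zero} _ = refl
count-none {suc k} {P} none rewrite none zero = count-none (none ∘ suc)

count-positive : (P : Fin k → Bool) {i : Fin k} → P i ≡ true → 0 < count P
count-positive {suc k} P {zero} Pi rewrite Pi = s≤s z≤n
count-positive {suc k} P {suc i} Pi with P zero
... | true = s≤s z≤n
... | false = count-positive (P ∘ suc) Pi

count-witness : (P : Fin k → Bool) → 0 < count P → ∃ λ i → P i ≡ true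
count-witness {suc k} P pos with P zero in P0
... | true = zero , P0
... | false with count-witness (P ∘ suc) pos
... | i , Pi = suc i , Pi

count-mono : {P Q : Fin k → Bool} → P ⊆ Q → count P ≤ count Q
count-mono {zero} _ = z≤n
count-mono {suc k} {P} {Q} P⊆Q with P zero in P0 | Q zero in Q0
... | true | true = s≤s (count-mono (P⊆Q ∘ suc))
... | true | false = contradiction Q0 (true≢false (P⊆Q zero P0))
... | false | true = m≤n⇒m≤1+n (count-mono (P⊆Q ∘ suc))
... | false | false = count-mono (P⊆Q ∘ suc)

count-split : (P Q : Fin k → Bool) → count P ≡ count (P ∩ Q) + count (P ∖ Q)
count-split {zero} P Q = refl
count-split {suc k} P Q with P zero | Q zero
... | true | true = cong suc (count-split (P ∘ suc) (Q ∘ suc))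
... | true | false = trans (cong suc (count-split (P ∘ suc) (Q ∘ suc))) (sym (+-suc _ _))
... | false | true = count-split (P ∘ suc) (Q ∘ suc)
... | false | false = count-split (P ∘ suc) (Q ∘ suc)

count-singleton : (P : Fin k → Bool) {x : Fin k} → P x ≡ true → (∀ i → P i ≡ true → i ≡ x) →
  count P ≡ 1
count-singleton {suc k} P {zero} Px only rewrite Px = cong suc (count-none others)
  where
  others : ∀ i → P (suc i) ≡ false
  others i with P (suc i) in Pi
  ... | true with () ← only (suc i) Pi
  ... | false = refl
count-singleton {suc k} P {suc x} Px only with P zero in P0
... | true with () ← only zero P0
... | false = count-singleton (P ∘ suc) Px (λ i Pi → Finₚ.suc-injective (only (suc i) Pi))

count-｛｝ : (x : Fin k) → count ｛ x ｝ ≡ 1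
count-｛｝ x = count-singleton ｛ x ｝ (∈｛｝ x) (λ i → ∈｛｝⇒≡)

count-⊆｛｝ : (P : Fin k → Bool) {x : Fin k} → (∀ i → P i ≡ true → i ≡ x) →
  count P ≡ 𝟙 (P x)
count-⊆｛｝ P {x} only with P x in Px
... | true = count-singleton P Px only
... | false = count-none none
  where
  none : ∀ i → P i ≡ false
  none i with P i in Pi
  ... | true = contradiction Px (true≢false (subst (λ j → P j ≡ true) (only i Pi) Pi))
  ... | false = refl

count-⊆｛,｝ : (P : Fin k → Bool) {x y : Fin k} → x ≢ y →
  (∀ i → P i ≡ true → i ≡ x ⊎ i ≡ y) → count P ≡ 𝟙 (P x) + 𝟙 (P y)
count-⊆｛,｝ P {x} {y} x≢y only =
  trans (count-split P ｛ x ｝) (cong₂ _+_ at-x off-x)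
  where
  at-x : count (P ∩ ｛ x ｝) ≡ 𝟙 (P x)
  at-x = trans (count-⊆｛｝ (P ∩ ｛ x ｝) (λ i p → ∈｛｝⇒≡ (∧-elimʳ {P i} p)))
               (cong 𝟙 (trans (cong (P x ∧_) (∈｛｝ x)) (∧-identityʳ (P x))))
  off-x : count (P ∖ ｛ x ｝) ≡ 𝟙 (P y)
  off-x = trans (count-⊆｛｝ (P ∖ ｛ x ｝) only-y)
                (cong 𝟙 (trans (cong (λ b → P y ∧ not b) (∉｛｝ (≢-sym x≢y))) (∧-identityʳ (P y))))
    where
    only-y : ∀ i → (P ∖ ｛ x ｝) i ≡ true → i ≡ y
    only-y i p with only i (∧-elimˡ p)
    ... | inj₁ refl = contradiction (not-elim (∧-elimʳ {P i} p)) (true≢false (∈｛｝ i))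
    ... | inj₂ i≡y = i≡y

count-doubleton : (P : Fin k → Bool) {x y : Fin k} → x ≢ y → P x ≡ true → P y ≡ true →
  (∀ i → P i ≡ true → i ≡ x ⊎ i ≡ y) → count P ≡ 2
count-doubleton P x≢y Px Py only =
  trans (count-⊆｛,｝ P x≢y only) (cong₂ (λ a b → 𝟙 a + 𝟙 b) Px Py)

count-｛x,y｝ : {x y : Fin k} → x ≢ y → count (｛ x ｝ ∪ ｛ y ｝) ≡ 2
count-｛x,y｝ {x = x} {y} x≢y =
  count-doubleton (｛ x ｝ ∪ ｛ y ｝) x≢y (∨-introˡ (∈｛｝ x)) (∨-introʳ (∈｛｝ y))
    (λ _ → ∈｛,｝⇒)

count-｛x,x｝ : (x : Fin k) → count (｛ x ｝ ∪ ｛ x ｝) ≡ 1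
count-｛x,x｝ x = count-singleton (｛ x ｝ ∪ ｛ x ｝) {x} (∨-introˡ (∈｛｝ x))
  (λ i p → Sum.reduce (∈｛,｝⇒ {i = i} p))

sum-if : (Z : Fin k → Bool) (c : ℕ) → sum (λ i → if Z i then c else 0) ≡ c * count Z
sum-if {zero} Z c = sym (*-zeroʳ c)
sum-if {suc k} Z c with Z zero
... | true = trans (cong (c +_) (sum-if (Z ∘ suc) c)) (sym (*-suc c _))
... | false = sum-if (Z ∘ suc) c

count-disjoint-∪ : (P Q : Fin k → Bool) → (∀ i → P i ≡ true → Q i ≡ false) →
  count (P ∪ Q) ≡ count P + count Q
count-disjoint-∪ P Q disjoint =
  trans (count-split (P ∪ Q) P) (cong₂ _+_ (count-cong inside) (count-cong outside))
  where
  inside : (P ∪ Q) ∩ P ≗ P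
  inside i with P i
  ... | true = refl
  ... | false = ∧-zeroʳ (Q i)
  outside : (P ∪ Q) ∖ P ≗ Q
  outside i with P i in Pi
  ... | true = sym (disjoint i Pi)
  ... | false = ∧-identityʳ (Q i)

count-⊆-split : (P Q : Fin k → Bool) → P ⊆ Q → count Q ≡ count P + count (Q ∖ P)
count-⊆-split P Q P⊆Q = trans (count-split Q P) (cong (_+ count (Q ∖ P)) (count-cong Q∩P≗P))
  where
  Q∩P≗P : Q ∩ P ≗ P
  Q∩P≗P i with P i in Pi
  ... | true = cong (_∧ true) (P⊆Q i Pi)
  ... | false = ∧-zeroʳ (Q i)

count-remove : (Z : Fin k → Bool) {z : Fin k} → Z z ≡ true → count Z ≡ suc (count (Z ∖ ｛ z ｝))
count-remove Z {z} Zz =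
  trans (count-⊆-split ｛ z ｝ Z (λ x x≡z → subst (λ x → Z x ≡ true) (sym (∈｛｝⇒≡ x≡z)) Zz))
        (cong (_+ count (Z ∖ ｛ z ｝)) (count-｛｝ z))

-- Hall's theorem for bipartite multigraphs

module Hall {nA nB m : ℕ} (tail : Fin m → Fin nA) (head : Fin m → Fin nB) (default : Fin m) where

  Joins : (Fin nA → Bool) → Fin nB → Fin m → Set
  Joins S b g = S (tail g) ≡ true × head g ≡ b

  joins? : ∀ S b g → Dec (Joins S b g)
  joins? S b g = (S (tail g) Bool.≟ true) ×-dec (head g ≟ b)

  N : (Fin nA → Bool) → Fin nB → Bool
  N S b = ⌊ any? (joins? S b) ⌋

  N-intro : ∀ S g → S (tail g) ≡ true → N S (head g) ≡ true
  N-intro S g Sg = ⇒⌊⌋≡true (any? (joins? S (head g))) (g , Sg , refl)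

  N-elim : ∀ S {b} → N S b ≡ true → ∃ (Joins S b)
  N-elim S {b} = ⌊⌋≡true⇒ (any? (joins? S b))

  N-mono : ∀ S S' → S ⊆ S' → N S ⊆ N S'
  N-mono S S' S⊆S' b NSb with N-elim S NSb
  ... | g , Sg , refl = N-intro S' g (S⊆S' _ Sg)

  N-cong : ∀ {S S'} → S ≗ S' → N S ≗ N S'
  N-cong {S} {S'} S≗S' b =
    Bool-ext (N-mono S S' (λ a → trans (sym (S≗S' a))) b) (N-mono S' S (λ a → trans (S≗S' a)) b)

  N-∪ : ∀ S S' → N (S ∪ S') ⊆ N S ∪ N S'
  N-∪ S S' b NUb with N-elim (S ∪ S') NUb
  ... | g , Ug , refl with ∨-elim Ug
  ... | inj₁ Sg = ∨-introˡ (N-intro S g Sg)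
  ... | inj₂ S'g = ∨-introʳ (N-intro S' g S'g)

  HallCondition : (Fin nA → Bool) → (Fin nB → Bool) → Set
  HallCondition X Y = ∀ S → S ⊆ X → count S ≤ count (Y ∩ N S)

  -- edge a is arbitrary for a outside X.
  record Matching (X : Fin nA → Bool) (Y : Fin nB → Bool) : Set where
    field
      edge : Fin nA → Fin m
      tail-edge : ∀ a → X a ≡ true → tail (edge a) ≡ a
      head-edge : ∀ a → X a ≡ true → Y (head (edge a)) ≡ true
      head-injective : ∀ a a' → X a ≡ true → X a' ≡ true → head (edge a) ≡ head (edge a') → a ≡ a'
      head-surjective : ∀ b → Y b ≡ true → ∃ λ a → X a ≡ true × head (edge a) ≡ b

  open Matching

  empty-matching : ∀ {X Y} → count X ≡ 0 → count X ≡ count Y → Matching X Y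
  empty-matching {X} {Y} X≡0 X≡Y = record
    { edge = λ _ → default
    ; tail-edge = λ a Xa → ⊥-elim (nonempty X Xa X≡0)
    ; head-edge = λ a Xa → ⊥-elim (nonempty X Xa X≡0)
    ; head-injective = λ a _ Xa → ⊥-elim (nonempty X Xa X≡0)
    ; head-surjective = λ b Yb → ⊥-elim (nonempty Y Yb (trans (sym X≡Y) X≡0))
    }
    where
    nonempty : ∀ {k} (P : Fin k → Bool) {i} → P i ≡ true → count P ≢ 0
    nonempty P Pi P≡0 = <⇒≢ (count-positive P Pi) (sym P≡0)

  Tight : (Fin nA → Bool) → (Fin nB → Bool) → (Fin nA → Bool) → Set
  Tight X Y S = S ⊆ X × 0 < count S × count S < count X × count (Y ∩ N S) ≡ count S

  tight? : ∀ X Y S → Dec (Tight X Y S)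
  tight? X Y S = all? (λ a → (S a Bool.≟ true) →-dec (X a Bool.≟ true))
    ×-dec 0 ℕ.<? count S ×-dec count S ℕ.<? count X ×-dec count (Y ∩ N S) ℕ.≟ count S

  Tight-cong : ∀ {X Y S S'} → S ≗ S' → Tight X Y S → Tight X Y S'
  Tight-cong {X} {Y} {S} {S'} S≗S' (S⊆X , S>0 , S<X , tight) =
      (λ a S'a → S⊆X a (trans (S≗S' a) S'a))
    , subst (0 <_) S≡S' S>0
    , subst (_< count X) S≡S' S<X
    , trans (count-cong (λ b → cong (Y b ∧_) (sym (N-cong S≗S' b)))) (trans tight S≡S')
    where
    S≡S' : count S ≡ count S'
    S≡S' = count-cong S≗S'

  module TightSplit {X Y S} (hall : HallCondition X Y) (X≡Y : count X ≡ count Y)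
                    (S⊆X : S ⊆ X) (S>0 : 0 < count S) (tight : count (Y ∩ N S) ≡ count S) where

    inner-hall : HallCondition S (Y ∩ N S)
    inner-hall S' S'⊆S = ≤-trans (hall S' (λ a → S⊆X a ∘ S'⊆S a)) (count-mono into-N-S)
      where
      into-N-S : Y ∩ N S' ⊆ (Y ∩ N S) ∩ N S'
      into-N-S b p =
        ∧-intro (∧-intro (∧-elimˡ p) (N-mono S' S S'⊆S b (∧-elimʳ {Y b} p))) (∧-elimʳ {Y b} p)

    X-split : count X ≡ count S + count (X ∖ S)
    X-split = count-⊆-split S X S⊆X

    Y-split : count Y ≡ count S + count (Y ∖ N S)
    Y-split = trans (count-split Y (N S)) (cong (_+ count (Y ∖ N S)) tight)

    outer-balanced : count (X ∖ S) ≡ count (Y ∖ N S)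
    outer-balanced = +-cancelˡ-≡ (count S) _ _ (trans (sym X-split) (trans X≡Y Y-split))

    outer-smaller : count (X ∖ S) < count X
    outer-smaller = begin-strict
      count (X ∖ S)           <⟨ +-monoˡ-≤ (count (X ∖ S)) S>0 ⟩
      count S + count (X ∖ S) ≡⟨ sym X-split ⟩
      count X                 ∎
      where open ≤-Reasoning

    outer-hall : HallCondition (X ∖ S) (Y ∖ N S)
    outer-hall S' S'⊆X∖S = +-cancelˡ-≤ (count S) _ _ (begin
      count S + count S'                                   ≡⟨ sym (count-disjoint-∪ S S' S-S'-disjoint) ⟩
      count (S ∪ S')                                       ≤⟨ hall (S ∪ S') S∪S'⊆X ⟩
      count (Y ∩ N (S ∪ S'))                               ≤⟨ count-mono N-S∪S'-split ⟩
      count ((Y ∩ N S) ∪ ((Y ∖ N S) ∩ N S'))               ≡⟨ count-disjoint-∪ _ _ N-S-disjoint ⟩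
      count (Y ∩ N S) + count ((Y ∖ N S) ∩ N S')           ≡⟨ cong (_+ count ((Y ∖ N S) ∩ N S')) tight ⟩
      count S + count ((Y ∖ N S) ∩ N S')                   ∎)
      where
      open ≤-Reasoning
      S-S'-disjoint : ∀ a → S a ≡ true → S' a ≡ false
      S-S'-disjoint a Sa with S' a in S'a
      ... | false = refl
      ... | true = contradiction (not-elim (∧-elimʳ {X a} (S'⊆X∖S a S'a))) (true≢false Sa)
      S∪S'⊆X : S ∪ S' ⊆ X
      S∪S'⊆X a p with ∨-elim p
      ... | inj₁ Sa = S⊆X a Sa
      ... | inj₂ S'a = ∧-elimˡ (S'⊆X∖S a S'a)
      split : ∀ y s s' u → (u ≡ true → s ∨ s' ≡ true) → y ∧ u ≡ true →
        (y ∧ s) ∨ ((y ∧ not s) ∧ s') ≡ true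
      split true true _ true _ _ = refl
      split true false _ true u⇒s∨s' _ = u⇒s∨s' refl
      N-S∪S'-split : Y ∩ N (S ∪ S') ⊆ (Y ∩ N S) ∪ ((Y ∖ N S) ∩ N S')
      N-S∪S'-split b = split (Y b) (N S b) (N S' b) (N (S ∪ S') b) (N-∪ S S' b)
      disjoint : ∀ y s s' → y ∧ s ≡ true → (y ∧ not s) ∧ s' ≡ false
      disjoint true true _ _ = refl
      N-S-disjoint : ∀ b → (Y ∩ N S) b ≡ true → ((Y ∖ N S) ∩ N S') b ≡ false
      N-S-disjoint b = disjoint (Y b) (N S b) (N S' b)

    combine : Matching S (Y ∩ N S) → Matching (X ∖ S) (Y ∖ N S) → Matching X Y
    combine inner outer = record
      { edge = edge′
      ; tail-edge = tail-edge′
      ; head-edge = head-edge′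
      ; head-injective = head-injective′
      ; head-surjective = head-surjective′
      }
      where
      edge′ : Fin nA → Fin m
      edge′ a = if S a then edge inner a else edge outer a
      edge′-inner : ∀ {a} → S a ≡ true → edge′ a ≡ edge inner a
      edge′-inner Sa rewrite Sa = refl
      edge′-outer : ∀ {a} → S a ≡ false → edge′ a ≡ edge outer a
      edge′-outer ¬Sa rewrite ¬Sa = refl
      X∖S-intro : ∀ {a} → X a ≡ true → S a ≡ false → (X ∖ S) a ≡ true
      X∖S-intro Xa ¬Sa = ∧-intro Xa (not-intro ¬Sa)
      inner-in-N-S : ∀ a → S a ≡ true → N S (head (edge inner a)) ≡ true
      inner-in-N-S a Sa = ∧-elimʳ (head-edge inner a Sa)
      outer-off-N-S : ∀ a → (X ∖ S) a ≡ true → N S (head (edge outer a)) ≡ false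
      outer-off-N-S a p = not-elim (∧-elimʳ {Y (head (edge outer a))} (head-edge outer a p))
      tail-edge′ : ∀ a → X a ≡ true → tail (edge′ a) ≡ a
      tail-edge′ a Xa with S a in Sa
      ... | true = tail-edge inner a Sa
      ... | false = tail-edge outer a (X∖S-intro Xa Sa)
      head-edge′ : ∀ a → X a ≡ true → Y (head (edge′ a)) ≡ true
      head-edge′ a Xa with S a in Sa
      ... | true = ∧-elimˡ (head-edge inner a Sa)
      ... | false = ∧-elimˡ (head-edge outer a (X∖S-intro Xa Sa))
      head-injective′ : ∀ a a' → X a ≡ true → X a' ≡ true →
        head (edge′ a) ≡ head (edge′ a') → a ≡ a'
      head-injective′ a a' Xa Xa' same with S a in Sa | S a' in Sa'
      ... | true | true = head-injective inner a a' Sa Sa' same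
      ... | false | false = head-injective outer a a' (X∖S-intro Xa Sa) (X∖S-intro Xa' Sa') same
      ... | true | false = contradiction (outer-off-N-S a' (X∖S-intro Xa' Sa'))
                             (true≢false (subst (λ b → N S b ≡ true) same (inner-in-N-S a Sa)))
      ... | false | true = contradiction (outer-off-N-S a (X∖S-intro Xa Sa))
                             (true≢false (subst (λ b → N S b ≡ true) (sym same) (inner-in-N-S a' Sa')))
      head-surjective′ : ∀ b → Y b ≡ true → ∃ λ a → X a ≡ true × head (edge′ a) ≡ b
      head-surjective′ b Yb with N S b in NSb
      ... | true with head-surjective inner b (∧-intro Yb NSb)
      ...   | a , Sa , hit = a , S⊆X a Sa , trans (cong head (edge′-inner Sa)) hit
      head-surjective′ b Yb | false with head-surjective outer b (∧-intro Yb (not-intro NSb))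
      ...   | a , p , hit = a , ∧-elimˡ p , trans (cong head (edge′-outer (not-elim (∧-elimʳ {X a} p)))) hit

  module LooseExtension {X Y} (hall : HallCondition X Y) (no-tight : ∀ S → ¬ Tight X Y S)
                        {a₀} (Xa₀ : X a₀ ≡ true) where

    first-edge : ∃ λ g → tail g ≡ a₀ × Y (head g) ≡ true
    first-edge with count-witness (Y ∩ N ｛ a₀ ｝)
                      (subst (_≤ count (Y ∩ N ｛ a₀ ｝)) (count-｛｝ a₀) (hall ｛ a₀ ｝ ｛a₀｝⊆X))
      where
      ｛a₀｝⊆X : ｛ a₀ ｝ ⊆ X
      ｛a₀｝⊆X a a≡a₀ = subst (λ x → X x ≡ true) (sym (∈｛｝⇒≡ a≡a₀)) Xa₀
    ... | b , p with N-elim ｛ a₀ ｝ (∧-elimʳ {Y b} p)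
    ... | g , tail≡a₀ , refl = g , ∈｛｝⇒≡ tail≡a₀ , ∧-elimˡ p

    g₀ : Fin m
    g₀ = proj₁ first-edge

    b₀ : Fin nB
    b₀ = head g₀

    X′ : Fin nA → Bool
    X′ = X ∖ ｛ a₀ ｝

    Y′ : Fin nB → Bool
    Y′ = Y ∖ ｛ b₀ ｝

    reduced-balanced : count X ≡ count Y → count X′ ≡ count Y′
    reduced-balanced X≡Y =
      suc-injective (trans (sym (count-remove X Xa₀)) (trans X≡Y (count-remove Y (proj₂ (proj₂ first-edge)))))

    reduced-smaller : count X′ < count X
    reduced-smaller = ≤-reflexive (sym (count-remove X Xa₀))

    reduced-hall : HallCondition X′ Y′
    reduced-hall S S⊆X′ with count S ℕ.≟ 0
    ... | yes S≡0 = subst (_≤ count (Y′ ∩ N S)) (sym S≡0) z≤n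
    ... | no S≢0 = ≤-pred (begin-strict
      count S                       <⟨ not-tight ⟩
      count (Y ∩ N S)               ≡⟨ count-split (Y ∩ N S) ｛ b₀ ｝ ⟩
      count ((Y ∩ N S) ∩ ｛ b₀ ｝) + count ((Y ∩ N S) ∖ ｛ b₀ ｝)
                                    ≤⟨ +-mono-≤ at-most-b₀ (count-mono rest) ⟩
      1 + count (Y′ ∩ N S)          ∎)
      where
      open ≤-Reasoning
      S⊆X : S ⊆ X
      S⊆X a Sa = ∧-elimˡ (S⊆X′ a Sa)
      not-tight : count S < count (Y ∩ N S)
      not-tight = ≤∧≢⇒< (hall S S⊆X) λ S≡ →
        no-tight S (S⊆X , n≢0⇒n>0 S≢0 , <-≤-trans (s≤s (count-mono S⊆X′)) reduced-smaller , sym S≡)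
      at-most-b₀ : count ((Y ∩ N S) ∩ ｛ b₀ ｝) ≤ 1
      at-most-b₀ = subst (count ((Y ∩ N S) ∩ ｛ b₀ ｝) ≤_) (count-｛｝ b₀)
                         (count-mono λ b p → ∧-elimʳ {(Y ∩ N S) b} p)
      swap : ∀ y n c → (y ∧ n) ∧ not c ≡ true → (y ∧ not c) ∧ n ≡ true
      swap true true false _ = refl
      rest : (Y ∩ N S) ∖ ｛ b₀ ｝ ⊆ Y′ ∩ N S
      rest b = swap (Y b) (N S b) (｛ b₀ ｝ b)

    extend : Matching X′ Y′ → Matching X Y
    extend M = record
      { edge = edge′
      ; tail-edge = tail-edge′
      ; head-edge = head-edge′
      ; head-injective = head-injective′
      ; head-surjective = head-surjective′
      }
      where
      edge′ : Fin nA → Fin m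
      edge′ a = if ｛ a₀ ｝ a then g₀ else edge M a
      edge′-a₀ : edge′ a₀ ≡ g₀
      edge′-a₀ = cong (if_then g₀ else edge M a₀) (∈｛｝ a₀)
      edge′-else : ∀ {a} → a ≢ a₀ → edge′ a ≡ edge M a
      edge′-else {a} a≢a₀ = cong (if_then g₀ else edge M a) (∉｛｝ a≢a₀)
      X′-intro : ∀ {a} → X a ≡ true → a ≢ a₀ → X′ a ≡ true
      X′-intro Xa a≢a₀ = ∧-intro Xa (not-intro (∉｛｝ a≢a₀))
      head-not-b₀ : ∀ {a} → X′ a ≡ true → head (edge M a) ≢ b₀
      head-not-b₀ {a} X′a = ∉-removed Y (head-edge M a X′a)
      tail-edge′ : ∀ a → X a ≡ true → tail (edge′ a) ≡ a
      tail-edge′ a Xa with a ≟ a₀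
      ... | yes a≡a₀ = trans (proj₁ (proj₂ first-edge)) (sym a≡a₀)
      ... | no a≢a₀ = tail-edge M a (X′-intro Xa a≢a₀)
      head-edge′ : ∀ a → X a ≡ true → Y (head (edge′ a)) ≡ true
      head-edge′ a Xa with a ≟ a₀
      ... | yes _ = proj₂ (proj₂ first-edge)
      ... | no a≢a₀ = ∧-elimˡ (head-edge M a (X′-intro Xa a≢a₀))
      head-injective′ : ∀ a a' → X a ≡ true → X a' ≡ true →
        head (edge′ a) ≡ head (edge′ a') → a ≡ a'
      head-injective′ a a' Xa Xa' same with a ≟ a₀ | a' ≟ a₀
      ... | yes a≡a₀ | yes a'≡a₀ = trans a≡a₀ (sym a'≡a₀)
      ... | no a≢a₀ | no a'≢a₀ =
            head-injective M a a' (X′-intro Xa a≢a₀) (X′-intro Xa' a'≢a₀) same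
      ... | yes _ | no a'≢a₀ = contradiction (sym same) (head-not-b₀ (X′-intro Xa' a'≢a₀))
      ... | no a≢a₀ | yes _ = contradiction same (head-not-b₀ (X′-intro Xa a≢a₀))
      head-surjective′ : ∀ b → Y b ≡ true → ∃ λ a → X a ≡ true × head (edge′ a) ≡ b
      head-surjective′ b Yb with b ≟ b₀
      ... | yes b≡b₀ = a₀ , Xa₀ , trans (cong head edge′-a₀) (sym b≡b₀)
      ... | no b≢b₀ with head-surjective M b (∧-intro Yb (not-intro (∉｛｝ b≢b₀)))
      ...   | a , X′a , hit = a , ∧-elimˡ X′a , trans (cong head (edge′-else (∉-removed X X′a))) hit

  -- Halmos–Vaughan induction on |X|: a tight set S splits the problem into S → N(S) and
  -- X ∖ S → Y ∖ N(S); if there is none, any edge from a vertex of X into Y can be matched.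
  hall-bounded : ∀ n X Y → count X ≤ n → count X ≡ count Y → HallCondition X Y → Matching X Y
  hall-bounded zero X Y X≤0 X≡Y _ = empty-matching (n≤0⇒n≡0 X≤0) X≡Y
  hall-bounded (suc n) X Y X≤1+n X≡Y hall
    with count X ℕ.≟ 0 | anySubset? (tight? X Y ∘ lookup)
  ... | yes X≡0 | _ = empty-matching X≡0 X≡Y
  ... | no _ | yes (v , S⊆X , S>0 , S<X , tight) =
    combine (hall-bounded n S (Y ∩ N S) (below S<X) (sym tight) inner-hall)
            (hall-bounded n (X ∖ S) (Y ∖ N S) (below outer-smaller) outer-balanced outer-hall)
    where
    S = lookup v
    open TightSplit hall X≡Y S⊆X S>0 tight
    below : ∀ {c} → c < count X → c ≤ n
    below c<X = ≤-pred (≤-trans c<X X≤1+n)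
  ... | no X≢0 | no no-tight-subset =
    extend (hall-bounded n X′ Y′ (≤-pred (≤-trans reduced-smaller X≤1+n))
                         (reduced-balanced X≡Y) reduced-hall)
    where
    no-tight : ∀ S → ¬ Tight X Y S
    no-tight S tight = no-tight-subset (tabulate S , Tight-cong (λ a → sym (lookup∘tabulate S a)) tight)
    open LooseExtension hall no-tight (proj₂ (count-witness X (n≢0⇒n>0 X≢0)))

  hall : ∀ {X Y} → count X ≡ count Y → HallCondition X Y → Matching X Y
  hall {X} {Y} = hall-bounded (count X) X Y ≤-refl

-- Cubic bipartite graphs

degree-as-sum : (G : Graph) (v : V G) → degree G v ≡ sum (incidence G v)
degree-as-sum G = go (n G) (m G) (ends G)
  where
  go : ∀ n m (ends : Fin m → Fin n × Fin n) v →
    degree (record { n = n ; m = m ; ends = ends }) v ≡ sum (incidence (record { n = n ; m = m ; ends = ends }) v)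
  go n zero ends v = refl
  go n (suc m) ends v =
    cong (incidence (record { n = n ; m = suc m ; ends = ends }) v zero +_) (go n m (ends ∘ suc) v)

module CubicBipartite (G : Graph) (cubic : Cubic G) (bipartite : Bipartite G) where

  colour : V G → Bool
  colour = proj₁ bipartite

  end₁ end₂ : E G → V G
  end₁ g = proj₁ (ends G g)
  end₂ g = proj₂ (ends G g)

  tail head : E G → V G
  tail g = if colour (end₁ g) then end₁ g else end₂ g
  head g = if colour (end₁ g) then end₂ g else end₁ g

  colour-tail : ∀ g → colour (tail g) ≡ true
  colour-tail g with colour (end₁ g) in c₁
  ... | true = c₁
  ... | false with colour (end₂ g) in c₂
  ...   | true = refl
  ...   | false = contradiction (trans c₁ (sym c₂)) (proj₂ bipartite g)

  colour-head : ∀ g → colour (head g) ≡ false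
  colour-head g with colour (end₁ g) in c₁
  ... | false = c₁
  ... | true with colour (end₂ g) in c₂
  ...   | false = refl
  ...   | true = contradiction (trans c₁ (sym c₂)) (proj₂ bipartite g)

  tail≢head : ∀ g → tail g ≢ head g
  tail≢head g same = true≢false (colour-tail g) (trans (cong colour same) (colour-head g))

  loopless : ∀ g → end₁ g ≢ end₂ g
  loopless g same = proj₂ bipartite g (cong colour same)

  incident-tail : ∀ g → incident G (tail g) g ≡ true
  incident-tail g with colour (end₁ g)
  ... | true = ∨-introˡ (∈｛｝ (end₁ g))
  ... | false = ∨-introʳ (∈｛｝ (end₂ g))

  incident-head : ∀ g → incident G (head g) g ≡ true
  incident-head g with colour (end₁ g)
  ... | true = ∨-introʳ (∈｛｝ (end₂ g))
  ... | false = ∨-introˡ (∈｛｝ (end₁ g))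

  incident⇒end : ∀ {v g} → incident G v g ≡ true → v ≡ tail g ⊎ v ≡ head g
  incident⇒end {v} {g} p with colour (end₁ g) | ∨-elim p
  ... | true | inj₁ at₁ = inj₁ (sym (∈｛｝⇒≡ at₁))
  ... | true | inj₂ at₂ = inj₂ (sym (∈｛｝⇒≡ at₂))
  ... | false | inj₁ at₁ = inj₂ (sym (∈｛｝⇒≡ at₁))
  ... | false | inj₂ at₂ = inj₁ (sym (∈｛｝⇒≡ at₂))

  white-incident⇒tail : ∀ {v g} → colour v ≡ true → incident G v g ≡ true → v ≡ tail g
  white-incident⇒tail {v} {g} white p with incident⇒end p
  ... | inj₁ v≡tail = v≡tail
  ... | inj₂ refl = contradiction (colour-head g) (true≢false white)

  black-incident⇒head : ∀ {v g} → colour v ≡ false → incident G v g ≡ true → v ≡ head g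
  black-incident⇒head {v} {g} black p with incident⇒end p
  ... | inj₂ v≡head = v≡head
  ... | inj₁ refl = contradiction black (true≢false (colour-tail g))

  degree≡count-incident : ∀ v → degree G v ≡ count (incident G v)
  degree≡count-incident v = begin
    degree G v                                     ≡⟨ degree-as-sum G v ⟩
    sum (incidence G v)                            ≡⟨ sum-cong-≗ incidence≡indicator ⟩
    sum (𝟙 ∘ incident G v)    ≡⟨ count-as-sum (incident G v) ⟨
    count (incident G v)                           ∎
    where
    open ≡-Reasoning
    incidence≡indicator : ∀ g → incidence G v g ≡ 𝟙 (incident G v g)
    incidence≡indicator g with ｛ v ｝ (end₁ g) in at₁ | ｛ v ｝ (end₂ g) in at₂
    ... | true | true = contradiction (trans (∈｛｝⇒≡ at₁) (sym (∈｛｝⇒≡ at₂))) (loopless g)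
    ... | true | false = refl
    ... | false | true = refl
    ... | false | false = refl

  count-incident : ∀ v → count (incident G v) ≡ 3
  count-incident v = trans (sym (degree≡count-incident v)) (cubic v)

  double-count : ∀ Z → 3 * count Z ≡ count (Z ∘ tail) + count (Z ∘ head)
  double-count Z = begin
    3 * count Z                                   ≡⟨ sum-if Z 3 ⟨
    sum (λ v → if Z v then 3 else 0)              ≡⟨ sum-cong-≗ at-vertex ⟩
    sum (λ v → count (Z-end v))                   ≡⟨ sum-cong-≗ (λ v → count-as-sum (Z-end v)) ⟩
    sum (λ v → sum (λ g → 𝟙 (Z-end v g)))         ≡⟨ ∑-comm (λ v g → 𝟙 (Z-end v g)) ⟩
    sum (λ g → sum (λ v → 𝟙 (Z-end v g)))         ≡⟨ sum-cong-≗ (λ g → count-as-sum (λ v → Z-end v g)) ⟨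
    sum (λ g → count (λ v → Z-end v g))           ≡⟨ sum-cong-≗ at-edge ⟩
    sum (λ g → 𝟙 (Z (tail g)) + 𝟙 (Z (head g)))   ≡⟨ ∑-distrib-+ (𝟙 ∘ Z ∘ tail) (𝟙 ∘ Z ∘ head) ⟩
    sum (𝟙 ∘ Z ∘ tail) + sum (𝟙 ∘ Z ∘ head)       ≡⟨ cong₂ _+_ (count-as-sum (Z ∘ tail))
                                                                 (count-as-sum (Z ∘ head)) ⟨
    count (Z ∘ tail) + count (Z ∘ head)           ∎
    where
    open ≡-Reasoning
    Z-end : V G → E G → Bool
    Z-end v g = Z v ∧ incident G v g
    at-vertex : ∀ v → (if Z v then 3 else 0) ≡ count (Z-end v)
    at-vertex v with Z v
    ... | true = sym (count-incident v)
    ... | false = sym (count-none {P = λ g → false ∧ incident G v g} (λ _ → refl))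
    at-end : ∀ {v g} → incident G v g ≡ true → 𝟙 (Z-end v g) ≡ 𝟙 (Z v)
    at-end {v} p = cong 𝟙 (trans (cong (Z v ∧_) p) (∧-identityʳ (Z v)))
    at-edge : ∀ g → count (λ v → Z-end v g) ≡ 𝟙 (Z (tail g)) + 𝟙 (Z (head g))
    at-edge g = trans (count-⊆｛,｝ (λ v → Z-end v g) (tail≢head g)
                                   (λ v p → incident⇒end (∧-elimʳ {Z v} p)))
                      (cong₂ _+_ (at-end (incident-tail g)) (at-end (incident-head g)))

  white-double-count : ∀ Z → Z ⊆ colour → 3 * count Z ≡ count (Z ∘ tail)
  white-double-count Z Z-white = begin
    3 * count Z                         ≡⟨ double-count Z ⟩
    count (Z ∘ tail) + count (Z ∘ head) ≡⟨ cong (count (Z ∘ tail) +_) (count-none heads-outside) ⟩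
    count (Z ∘ tail) + 0                ≡⟨ +-identityʳ _ ⟩
    count (Z ∘ tail)                    ∎
    where
    open ≡-Reasoning
    heads-outside : ∀ g → Z (head g) ≡ false
    heads-outside g with Z (head g) in Zh
    ... | true = contradiction (colour-head g) (true≢false (Z-white _ Zh))
    ... | false = refl

  black-double-count : ∀ Z → Z ⊆ not ∘ colour → 3 * count Z ≡ count (Z ∘ head)
  black-double-count Z Z-black = trans (double-count Z) (cong (_+ count (Z ∘ head)) (count-none tails-outside))
    where
    tails-outside : ∀ g → Z (tail g) ≡ false
    tails-outside g with Z (tail g) in Zt
    ... | true = contradiction (not-elim (Z-black _ Zt)) (true≢false (colour-tail g))
    ... | false = refl

  balanced : count colour ≡ count (not ∘ colour)
  balanced = *-cancelˡ-≡ _ _ 3 (begin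
    3 * count colour              ≡⟨ white-double-count colour (λ _ white → white) ⟩
    count (colour ∘ tail)         ≡⟨ count-cong colour-tail ⟩
    count (λ (_ : E G) → true)    ≡⟨ count-cong (λ g → not-intro (colour-head g)) ⟨
    count ((not ∘ colour) ∘ head) ≡⟨ black-double-count (not ∘ colour) (λ _ black → black) ⟨
    3 * count (not ∘ colour)      ∎)
    where open ≡-Reasoning

  inCut-oriented : ∀ W g → inCut G W g ≡ W (tail g) xor W (head g)
  inCut-oriented W g with colour (end₁ g)
  ... | true = refl
  ... | false = xor-comm (W (end₁ g)) (W (end₂ g))

  inCut-crossing : ∀ W {g} → W (tail g) ≡ false → W (head g) ≡ true → inCut G W g ≡ true
  inCut-crossing W {g} outside inside = trans (inCut-oriented W g) (cong₂ _xor_ outside inside)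

  inCut-｛｝ : ∀ x → inCut G ｛ x ｝ ≗ incident G x
  inCut-｛｝ x g with ｛ x ｝ (end₁ g) in at₁
  ... | false = refl
  ... | true rewrite ∉｛｝ {x = x} (λ at₂ → loopless g (trans (∈｛｝⇒≡ at₁) (sym at₂))) = refl

  trivial-cut : ∀ x → count (inCut G ｛ x ｝) ≡ 3
  trivial-cut x = trans (count-cong (inCut-｛｝ x)) (count-incident x)

  -- If every edge leaving the white set S enters the black set T, then the edges of
  -- δ(S ∪ T) are exactly the edges entering T from outside S.
  boundary-count : ∀ S T → S ⊆ colour → T ⊆ not ∘ colour →
    (∀ g → S (tail g) ≡ true → T (head g) ≡ true) →
    3 * count T ≡ 3 * count S + count (inCut G (S ∪ T))
  boundary-count S T S-white T-black closed = begin
    3 * count T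
      ≡⟨ black-double-count T T-black ⟩
    count (T ∘ head)
      ≡⟨ count-split (T ∘ head) (S ∘ tail) ⟩
    count ((T ∘ head) ∩ (S ∘ tail)) + count ((T ∘ head) ∖ (S ∘ tail))
      ≡⟨ cong₂ _+_ (count-cong from-S) (count-cong from-outside) ⟩
    count (S ∘ tail) + count (inCut G (S ∪ T))
      ≡⟨ cong (_+ _) (white-double-count S S-white) ⟨
    3 * count S + count (inCut G (S ∪ T))
      ∎
    where
    open ≡-Reasoning
    from-S : (T ∘ head) ∩ (S ∘ tail) ≗ S ∘ tail
    from-S g with S (tail g) in St
    ... | true = cong (_∧ true) (closed g St)
    ... | false = ∧-zeroʳ _
    S-off-head : ∀ g → S (head g) ≡ false
    S-off-head g with S (head g) in Sh
    ... | true = contradiction (colour-head g) (true≢false (S-white _ Sh))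
    ... | false = refl
    T-off-tail : ∀ g → T (tail g) ≡ false
    T-off-tail g with T (tail g) in Tt
    ... | true = contradiction (not-elim (T-black _ Tt)) (true≢false (colour-tail g))
    ... | false = refl
    from-outside : (T ∘ head) ∖ (S ∘ tail) ≗ inCut G (S ∪ T)
    from-outside g rewrite inCut-oriented (S ∪ T) g | S-off-head g | T-off-tail g with S (tail g) in St
    ... | true rewrite closed g St = refl
    ... | false = ∧-identityʳ (T (head g))

  perfect-matching : ∀ M →
    (∀ {g g'} → M g ≡ true → M g' ≡ true → tail g ≡ tail g' → g ≡ g') →
    (∀ {g g'} → M g ≡ true → M g' ≡ true → head g ≡ head g' → g ≡ g') →
    (∀ v → colour v ≡ true → ∃ λ g → M g ≡ true × tail g ≡ v) →
    (∀ v → colour v ≡ false → ∃ λ g → M g ≡ true × head g ≡ v) →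
    PerfectMatching G M
  perfect-matching M tail-injective head-injective covers-white covers-black v with colour v in cv
  ... | true with covers-white v cv
  ...   | g , Mg , refl = count-singleton (λ g' → M g' ∧ incident G (tail g) g') (∧-intro Mg (incident-tail g))
            λ g' p → tail-injective (∧-elimˡ p) Mg (sym (white-incident⇒tail cv (∧-elimʳ {M g'} p)))
  perfect-matching M tail-injective head-injective covers-white covers-black v | false with covers-black v cv
  ...   | g , Mg , refl = count-singleton (λ g' → M g' ∧ incident G (head g) g') (∧-intro Mg (incident-head g))
            λ g' p → head-injective (∧-elimˡ p) Mg (sym (black-incident⇒head cv (∧-elimʳ {M g'} p)))

-- Perfect matchings through two given edges

c+3s≡3[t+1+q]⇒c+3d≡3q : ∀ {c s t q} → t < s → c + 3 * s ≡ 3 * (t + suc q) →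
  ∃ λ d → c + 3 * d ≡ 3 * q
c+3s≡3[t+1+q]⇒c+3d≡3q {c} {s} {t} {q} t<s eq with m≤n⇒∃[o]m+o≡n t<s
... | d , refl = d , +-cancelˡ-≡ (3 * suc t) _ _ (begin
  3 * suc t + (c + 3 * d) ≡⟨ lhs c t d ⟩
  c + 3 * (suc t + d)     ≡⟨ eq ⟩
  3 * (t + suc q)         ≡⟨ rhs t q ⟩
  3 * suc t + 3 * q       ∎)
  where
  open ≡-Reasoning
  lhs : ∀ c t d → 3 * suc t + (c + 3 * d) ≡ c + 3 * (suc t + d)
  lhs = solve-∀
  rhs : ∀ t q → 3 * (t + suc q) ≡ 3 * suc t + 3 * q
  rhs = solve-∀

c+3d≡3⇒c≡3 : ∀ {c} d → c + 3 * d ≡ 3 → 2 ≤ c → c ≡ 3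
c+3d≡3⇒c≡3 {c} zero eq _ = trans (sym (+-identityʳ c)) eq
c+3d≡3⇒c≡3 {c} (suc d) eq 2≤c =
  contradiction eq (>⇒≢ (≤-trans (n≤1+n 4) (+-mono-≤ 2≤c (*-monoʳ-≤ 3 (s≤s z≤n)))))

module TwoEdges (G : Graph) (cubic : Cubic G) (bipartite : Bipartite G) (e f : E G)
                (no-3-cut : ∀ W → Is3EdgeCut G W → countPair G W e f ≤ 1) where

  open CubicBipartite G cubic bipartite

  countPair≡2 : e ≢ f → ∀ W → inCut G W e ≡ true → inCut G W f ≡ true → countPair G W e f ≡ 2
  countPair≡2 e≢f W e∈δW f∈δW = count-doubleton ((｛ e ｝ ∪ ｛ f ｝) ∩ inCut G W) e≢f
    (∧-intro (∨-introˡ (∈｛｝ e)) e∈δW) (∧-intro (∨-introʳ (∈｛｝ f)) f∈δW)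
    (λ g p → ∈｛,｝⇒ (∧-elimˡ p))

  not-both-in-3-cut : e ≢ f → ∀ W → ProperNonempty G W → inCut G W e ≡ true → inCut G W f ≡ true →
    count (inCut G W) ≢ 3
  not-both-in-3-cut e≢f W proper e∈δW f∈δW three =
    <⇒≱ (s≤s (s≤s z≤n))
        (subst (_≤ 1) (countPair≡2 e≢f W e∈δW f∈δW) (no-3-cut W (proper , three)))

  -- The trivial cut at a common end of e and f would contain both.
  distinct-ends : e ≢ f → tail e ≢ tail f × head e ≢ head f
  distinct-ends e≢f = shared-end-contradiction (≢-sym (tail≢head e)) (incident-tail e) (incident-tail f)
                    , shared-end-contradiction (tail≢head e) (incident-head e) (incident-head f)
    where
    shared-end-contradiction : ∀ {x y x'} → y ≢ x → incident G x e ≡ true → incident G x' f ≡ true →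
      x ≢ x'
    shared-end-contradiction {x} {y} y≢x at-e at-f refl =
      not-both-in-3-cut e≢f ｛ x ｝ ((x , ∈｛｝ x) , (y , ∉｛｝ y≢x))
        (trans (inCut-｛｝ x e) at-e) (trans (inCut-｛｝ x f) at-f) (trivial-cut x)

  u₁ v₁ u₂ v₂ : V G
  u₁ = tail e
  v₁ = head e
  u₂ = tail f
  v₂ = head f

  same-tail⇒≡ : u₁ ≡ u₂ → e ≡ f
  same-tail⇒≡ same with e ≟ f
  ... | yes e≡f = e≡f
  ... | no e≢f = contradiction same (proj₁ (distinct-ends e≢f))

  same-head⇒≡ : v₁ ≡ v₂ → e ≡ f
  same-head⇒≡ same with e ≟ f
  ... | yes e≡f = e≡f
  ... | no e≢f = contradiction same (proj₂ (distinct-ends e≢f))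

  tails heads : V G → Bool
  tails = ｛ u₁ ｝ ∪ ｛ u₂ ｝
  heads = ｛ v₁ ｝ ∪ ｛ v₂ ｝

  A B : V G → Bool
  A = colour ∖ tails
  B = (not ∘ colour) ∖ heads

  count-tails≡count-heads : count tails ≡ count heads
  count-tails≡count-heads with e ≟ f
  ... | yes refl = trans (count-｛x,x｝ u₁) (sym (count-｛x,x｝ v₁))
  ... | no e≢f with distinct-ends e≢f
  ...   | u₁≢u₂ , v₁≢v₂ = trans (count-｛x,y｝ u₁≢u₂) (sym (count-｛x,y｝ v₁≢v₂))

  tails-white : tails ⊆ colour
  tails-white v p with ∈｛,｝⇒ {x = u₁} {u₂} {v} p
  ... | inj₁ refl = colour-tail e
  ... | inj₂ refl = colour-tail f

  heads-black : heads ⊆ not ∘ colour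
  heads-black v p with ∈｛,｝⇒ {x = v₁} {v₂} {v} p
  ... | inj₁ refl = not-intro (colour-head e)
  ... | inj₂ refl = not-intro (colour-head f)

  A-B-balanced : count A ≡ count B
  A-B-balanced = +-cancelˡ-≡ (count tails) _ _ (begin
    count tails + count A                            ≡⟨ count-⊆-split tails colour tails-white ⟨
    count colour                                     ≡⟨ balanced ⟩
    count (not ∘ colour)                             ≡⟨ count-⊆-split heads (not ∘ colour) heads-black ⟩
    count heads + count B                            ≡⟨ cong (_+ count B) count-tails≡count-heads ⟨
    count tails + count B                            ∎)
    where open ≡-Reasoning

  open Hall tail head e

  module CutAround (S : V G → Bool) (S⊆A : S ⊆ A) where

    T W : V G → Bool
    T = (B ∩ N S) ∪ heads
    W = S ∪ T

    S-white : S ⊆ colour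
    S-white v Sv = ∧-elimˡ (S⊆A v Sv)

    T-black : T ⊆ not ∘ colour
    T-black v Tv with ∨-elim Tv
    ... | inj₁ p = ∧-elimˡ (∧-elimˡ {B v} p)
    ... | inj₂ p = heads-black v p

    closed : ∀ g → S (tail g) ≡ true → T (head g) ≡ true
    closed g S-tail with heads (head g)
    ... | true = ∨-introʳ refl
    ... | false = ∨-introˡ (∧-intro (∧-intro (not-intro (colour-head g)) refl) (N-intro S g S-tail))

    cut-equation : ∀ {p} → count heads ≡ p → count (inCut G W) + 3 * count S ≡ 3 * (count (B ∩ N S) + p)
    cut-equation refl = begin
      count (inCut G W) + 3 * count S            ≡⟨ +-comm (count (inCut G W)) _ ⟩
      3 * count S + count (inCut G W)            ≡⟨ boundary-count S T S-white T-black closed ⟨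
      3 * count T                                ≡⟨ cong (3 *_) (count-disjoint-∪ _ _ B∩heads≡∅) ⟩
      3 * (count (B ∩ N S) + count heads)        ∎
      where
      open ≡-Reasoning
      B∩heads≡∅ : ∀ v → (B ∩ N S) v ≡ true → heads v ≡ false
      B∩heads≡∅ v p = not-elim (∧-elimʳ {not (colour v)} (∧-elimˡ {B v} p))

    W-tails : ∀ {v} → tails v ≡ true → W v ≡ false
    W-tails {v} at-tails with S v in Sv | T v in Tv
    ... | true | _ = contradiction (not-elim (∧-elimʳ {colour v} (S⊆A v Sv))) (true≢false at-tails)
    ... | false | true = contradiction (not-elim (T-black v Tv)) (true≢false (tails-white v at-tails))
    ... | false | false = refl

    W-heads : ∀ {v} → heads v ≡ true → W v ≡ true
    W-heads {v} at-heads = ∨-introʳ {S v} (∨-introʳ {(B ∩ N S) v} at-heads)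

    e∈δW : inCut G W e ≡ true
    e∈δW = inCut-crossing W (W-tails (∨-introˡ (∈｛｝ u₁))) (W-heads (∨-introˡ (∈｛｝ v₁)))

    f∈δW : inCut G W f ≡ true
    f∈δW = inCut-crossing W (W-tails (∨-introʳ (∈｛｝ u₂))) (W-heads (∨-introʳ (∈｛｝ v₂)))

    cut-surplus : ∀ {q} → count (B ∩ N S) < count S → count heads ≡ suc q →
      ∃ λ d → count (inCut G W) + 3 * d ≡ 3 * q
    cut-surplus deficient heads≡1+q =
      c+3s≡3[t+1+q]⇒c+3d≡3q {count (inCut G W)} deficient (cut-equation heads≡1+q)

    not-deficient : ¬ count (B ∩ N S) < count S
    not-deficient deficient with e ≟ f
    ... | yes refl with cut-surplus deficient (count-｛x,x｝ v₁)
    ...   | d , c+3d≡0 = <⇒≢ (count-positive (inCut G W) e∈δW) (sym (m+n≡0⇒m≡0 _ c+3d≡0))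
    not-deficient deficient | no e≢f with cut-surplus deficient (count-｛x,y｝ (proj₂ (distinct-ends e≢f)))
    ...   | d , c+3d≡3 = not-both-in-3-cut e≢f W
              ((v₁ , W-heads (∨-introˡ (∈｛｝ v₁))) , (u₁ , W-tails (∨-introˡ (∈｛｝ u₁))))
              e∈δW f∈δW (c+3d≡3⇒c≡3 d c+3d≡3 two-in-cut)
      where
      two-in-cut : 2 ≤ count (inCut G W)
      two-in-cut = subst (_≤ count (inCut G W)) (countPair≡2 e≢f W e∈δW f∈δW)
                         (count-mono (λ g p → ∧-elimʳ {(｛ e ｝ ∪ ｛ f ｝) g} p))

  hall-condition : HallCondition A B
  hall-condition S S⊆A = ≮⇒≥ (CutAround.not-deficient S S⊆A)

  matching : Matching A B
  matching = hall A-B-balanced hall-condition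

  open Matching matching

  M : E G → Bool
  M g = ｛ e ｝ g ∨ ｛ f ｝ g ∨ (A (tail g) ∧ ｛ g ｝ (edge (tail g)))

  data M-Edge (g : E G) : Set where
    is-e : g ≡ e → M-Edge g
    is-f : g ≡ f → M-Edge g
    chosen : A (tail g) ≡ true → edge (tail g) ≡ g → M-Edge g

  classify : ∀ {g} → M g ≡ true → M-Edge g
  classify p with ∨-elim p
  ... | inj₁ at-e = is-e (∈｛｝⇒≡ at-e)
  ... | inj₂ q with ∨-elim q
  ...   | inj₁ at-f = is-f (∈｛｝⇒≡ at-f)
  ...   | inj₂ r = chosen (∧-elimˡ r) (∈｛｝⇒≡ (∧-elimʳ r))

  M-e : M e ≡ true
  M-e = ∨-introˡ (∈｛｝ e)

  M-f : M f ≡ true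
  M-f = ∨-introʳ {｛ e ｝ f} (∨-introˡ (∈｛｝ f))

  M-chosen : ∀ {a} → A a ≡ true → M (edge a) ≡ true
  M-chosen {a} Aa = ∨-introʳ {｛ e ｝ (edge a)} (∨-introʳ {｛ f ｝ (edge a)}
    (∧-intro (subst (λ v → A v ≡ true) (sym (tail-edge a Aa)) Aa)
             (⇒⌊⌋≡true (_ ≟ _) (cong edge (tail-edge a Aa)))))

  chosen-head-in-B : ∀ {g} → A (tail g) ≡ true → edge (tail g) ≡ g → B (head g) ≡ true
  chosen-head-in-B A-tail hit = subst (λ g → B (head g) ≡ true) hit (head-edge _ A-tail)

  M-tail-injective : ∀ {g g'} → M g ≡ true → M g' ≡ true → tail g ≡ tail g' → g ≡ g'
  M-tail-injective p p' = go (classify p) (classify p')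
    where
    go : ∀ {g g'} → M-Edge g → M-Edge g' → tail g ≡ tail g' → g ≡ g'
    go (is-e refl) (is-e refl) _ = refl
    go (is-f refl) (is-f refl) _ = refl
    go (is-e refl) (is-f refl) same = same-tail⇒≡ same
    go (is-f refl) (is-e refl) same = sym (same-tail⇒≡ (sym same))
    go (is-e refl) (chosen A-tail _) same = contradiction (sym same) (proj₁ (∉-removed₂ colour A-tail))
    go (is-f refl) (chosen A-tail _) same = contradiction (sym same) (proj₂ (∉-removed₂ colour A-tail))
    go (chosen A-tail _) (is-e refl) same = contradiction same (proj₁ (∉-removed₂ colour A-tail))
    go (chosen A-tail _) (is-f refl) same = contradiction same (proj₂ (∉-removed₂ colour A-tail))
    go (chosen _ hit) (chosen _ hit') same = trans (sym hit) (trans (cong edge same) hit')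

  M-head-injective : ∀ {g g'} → M g ≡ true → M g' ≡ true → head g ≡ head g' → g ≡ g'
  M-head-injective p p' = go (classify p) (classify p')
    where
    avoids : ∀ {g} → A (tail g) ≡ true → edge (tail g) ≡ g → head g ≢ v₁ × head g ≢ v₂
    avoids A-tail hit = ∉-removed₂ (not ∘ colour) (chosen-head-in-B A-tail hit)
    go : ∀ {g g'} → M-Edge g → M-Edge g' → head g ≡ head g' → g ≡ g'
    go (is-e refl) (is-e refl) _ = refl
    go (is-f refl) (is-f refl) _ = refl
    go (is-e refl) (is-f refl) same = same-head⇒≡ same
    go (is-f refl) (is-e refl) same = sym (same-head⇒≡ (sym same))
    go (is-e refl) (chosen A-tail hit) same = contradiction (sym same) (proj₁ (avoids A-tail hit))
    go (is-f refl) (chosen A-tail hit) same = contradiction (sym same) (proj₂ (avoids A-tail hit))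
    go (chosen A-tail hit) (is-e refl) same = contradiction same (proj₁ (avoids A-tail hit))
    go (chosen A-tail hit) (is-f refl) same = contradiction same (proj₂ (avoids A-tail hit))
    go {g} {g'} (chosen A-tail hit) (chosen A-tail' hit') same =
      trans (sym hit) (trans (cong edge (head-injective _ _ A-tail A-tail' heads-agree)) hit')
      where
      heads-agree : head (edge (tail g)) ≡ head (edge (tail g'))
      heads-agree = trans (cong head hit) (trans same (sym (cong head hit')))

  M-covers-white : ∀ v → colour v ≡ true → ∃ λ g → M g ≡ true × tail g ≡ v
  M-covers-white v white with tails v in at-tails
  ... | false = edge v , M-chosen Av , tail-edge v Av
    where Av = ∧-intro white (not-intro at-tails)
  ... | true with ∈｛,｝⇒ {x = u₁} {u₂} {v} at-tails
  ...   | inj₁ refl = e , M-e , refl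
  ...   | inj₂ refl = f , M-f , refl

  M-covers-black : ∀ v → colour v ≡ false → ∃ λ g → M g ≡ true × head g ≡ v
  M-covers-black v black with heads v in at-heads
  ... | false with head-surjective v (∧-intro (not-intro black) (not-intro at-heads))
  ...   | a , Aa , hit = edge a , M-chosen Aa , hit
  M-covers-black v black | true with ∈｛,｝⇒ {x = v₁} {v₂} {v} at-heads
  ...   | inj₁ refl = e , M-e , refl
  ...   | inj₂ refl = f , M-f , refl

  M-perfect : PerfectMatching G M
  M-perfect = perfect-matching M M-tail-injective M-head-injective M-covers-white M-covers-black

mainTheorem11 : (G : Graph) → Cubic G → Bipartite G → (e f : E G) →
    (∀ (W : V G → Bool) → Is3EdgeCut G W → countPair G W e f ≤ 1) →
    Σ (E G → Bool) (λ M → PerfectMatching G M × M e ≡ true × M f ≡ true)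
mainTheorem11 G cubic bipartite e f no-3-cut = M , M-perfect , M-e , M-f
  where open TwoEdges G cubic bipartite e f no-3-cut
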